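{- Let $n,s,k,l$ be integers with $k\ge 1$, $k\le l\le s-1$ and $s\le n$. Let $\tilde{\mathcal{P}}^l_{n;\le s;k}$ be the set of $k$-flaw preference sets $\alpha=(a_1,\dots,a_n)$ with $n$ spaces such that $a_i\le s$ for all $i$, $a_1=l$, and $m_\alpha<l$. Then $$|\tilde{\mathcal{P}}^l_{n;\le s;k}|=\sum_{i=k-1}^{l-2}\binom{n-1}{i+1-k}\,p_{i+1-k,\,i;\le i}\;p^{\,l-i-1}_{n+k-i-1;\le s-i-1}.$$
   Context: Parking model: there are $m$ parking spaces in a line, numbered $1,\dots,m$. A preference set of length $N$ is a sequence $(a_1,\dots,a_N)$ of integers with $1\le a_i\le m$; cars $1,\dots,N$ arrive in order, car $i$ parks in the first unoccupied space numbered $\ge a_i$ if one exists, otherwise it fails to park. A $k$-flaw preference set is one in which exactly $k$ cars fail to park; a $0$-flaw one is a parking function. For a $k$-flaw preference set $\alpha$ of length $n$ with $n$ spaces ($k\ge1$), exactly $k$ spaces remain unoccupied after all cars have arrived; $m_\alpha$ denotes the largest-numbered unoccupied space. $p_{j,m;\le t}$ denotes the number of parking functions of length $j$ with $m$ spaces and all entries $\le t$ (the empty sequence counts, so $p_{0,m;\le t}=1$); $p^r_{j;\le t}$ denotes the number of parking functions $(b_1,\dots,b_j)$ of length $j$ with $j$ spaces, all entries $\le t$ and $b_1=r$. -}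

module Defs where

open import Data.Nat using (ℕ; zero; suc; _+_; _∸_; _≡ᵇ_; _<ᵇ_; _≤ᵇ_)
open import Data.Bool using (Bool; true; false; _∧_; if_then_else_)
open import Data.List using (List; []; _∷_; map; concatMap; replicate; length; filter; upTo)
open import Data.Nat.ListAction using (sum)
open import Data.Maybe using (Maybe; just; nothing)
open import Data.Product using (_×_; _,_; proj₁; proj₂)

-- A parking lot state: list of occupancy flags for spaces 1,2,...,m (true = occupied).
-- park a occ : the car with preference a takes the first unoccupied space
-- numbered ≥ a; returns nothing if no such space exists (the car fails to park).
park : ℕ → List Bool → Maybe (List Bool)
park _ [] = nothing
park (suc (suc a)) (b ∷ bs) with park (suc a) bs
... | just bs' = just (b ∷ bs')
... | nothing  = nothing
park zero (false ∷ bs) = just (true ∷ bs)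
park (suc zero) (false ∷ bs) = just (true ∷ bs)
park zero (true ∷ bs) with park zero bs
... | just bs' = just (true ∷ bs')
... | nothing  = nothing
park (suc zero) (true ∷ bs) with park (suc zero) bs
... | just bs' = just (true ∷ bs')
... | nothing  = nothing

run : List Bool → List ℕ → List Bool × ℕ
run occ [] = occ , 0
run occ (a ∷ as) with park a occ
... | just occ' = run occ' as
... | nothing   = let r = run occ as in proj₁ r , suc (proj₂ r)

flaws : ℕ → List ℕ → ℕ
flaws m α = proj₂ (run (replicate m false) α)

finalOcc : ℕ → List ℕ → List Bool
finalOcc m α = proj₁ (run (replicate m false) α)

-- largest-numbered unoccupied space (spaces numbered from 1); 0 if every space is occupied
lastFreeFrom : ℕ → List Bool → ℕ
lastFreeFrom i [] = 0
lastFreeFrom i (b ∷ bs) with lastFreeFrom (suc i) bs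
... | zero  = if b then 0 else i
... | suc j = suc j

lastFree : List Bool → ℕ
lastFree = lastFreeFrom 1

mα : ℕ → List ℕ → ℕ
mα m α = lastFree (finalOcc m α)

prefSets : ℕ → ℕ → List (List ℕ)
prefSets zero m = [] ∷ []
prefSets (suc j) m = concatMap (λ a → map (a ∷_) (prefSets j m)) (map suc (upTo m))

count : {A : Set} → (A → Bool) → List A → ℕ
count P xs = length (filter (λ x → Data.Bool._≟_ (P x) true) xs)

allLe : ℕ → List ℕ → Bool
allLe t [] = true
allLe t (a ∷ α) = (a ≤ᵇ t) ∧ allLe t α

headIs : ℕ → List ℕ → Bool
headIs r [] = false
headIs r (a ∷ _) = a ≡ᵇ r

-- p_{j,m;≤t}: parking functions of length j with m spaces, all entries ≤ t
pLe : ℕ → ℕ → ℕ → ℕ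
pLe j m t = count (λ α → allLe t α ∧ (flaws m α ≡ᵇ 0)) (prefSets j m)

-- p^r_{j;≤t}: parking functions (b_1,…,b_j) of length j with j spaces, entries ≤ t, b_1 = r
pHead : ℕ → ℕ → ℕ → ℕ
pHead r j t = count (λ α → allLe t α ∧ headIs r α ∧ (flaws j α ≡ᵇ 0)) (prefSets j j)

pTilde : ℕ → ℕ → ℕ → ℕ → ℕ
pTilde n s k l =
  count (λ α → allLe s α ∧ headIs l α ∧ (flaws n α ≡ᵇ k) ∧ (mα n α <ᵇ l)) (prefSets n n)

-- Σ_{i=a}^{b} f i  (empty when b < a)
sumFromTo : ℕ → ℕ → (ℕ → ℕ) → ℕ
sumFromTo a b f = sum (map (λ j → f (a + j)) (upTo (suc b ∸ a)))

-- Let α = (l, a₂, …, aₙ) be counted by pTilde n s k l and let i + 1 = m_α. Since space i + 1 stays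
-- free, no car prefers it and every car preferring a space ≤ i parks there: these low cars form a
-- parking function on the spaces 1, …, i. The high cars, with preferences shifted down by i + 1,
-- fill the r = n − i − 1 spaces to the right while exactly k of them fail; with preferences ≤ r this
-- means that they form a parking function on r + k spaces, here starting with l − i − 1. Counting
-- cars, i + 1 − k of them are low, and their positions among cars 2, …, n are arbitrary.

module Submission where

open import Defs
open import Data.Nat using (ℕ; zero; suc; _+_; _*_; _∸_; _≤_; _<_; z≤n; s≤s; _≡ᵇ_; _<ᵇ_; _≤ᵇ_; _⊓_)
open import Data.Nat.Properties
open import Algebra.Properties.CommutativeSemigroup +-commutativeSemigroup using (interchange)
open import Data.Nat.Combinatorics using (_C_; nCk+nC[k+1]≡[n+1]C[k+1])
open import Data.Nat.ListAction using (sum)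
open import Data.Nat.Tactic.RingSolver using (solve-∀)
open import Data.Bool.ListAction using (and)
open import Data.Bool.Properties using (∧-zeroʳ; ∧-comm; ∧-assoc)
open import Data.Bool using (Bool; true; false; _∧_; not; T; if_then_else_)
open import Data.Unit using (tt)
open import Data.Empty using (⊥; ⊥-elim)
open import Data.Product using (_×_; _,_; proj₁; proj₂; Σ-syntax)
open import Data.Sum using (inj₁; inj₂)
open import Data.List using (List; []; _∷_; map; concatMap; replicate; length; filter; upTo; applyUpTo; _++_)
open import Data.List.Properties using (map-applyUpTo; length-replicate; length-++; filter-++; ∷-injectiveʳ)
open import Data.List.Relation.Unary.All as All using (All; []; _∷_)
open import Data.List.Relation.Unary.All.Properties using (++⁺; map⁺)
open import Data.Maybe using (Maybe; just; nothing) renaming (map to mapᴹ)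
open import Data.Maybe.Properties using () renaming (map-id to mapᴹ-id; map-∘ to mapᴹ-∘)
open import Function using (_∘_)
open import Relation.Binary.Definitions using (tri<; tri≈; tri>)
open import Relation.Binary.PropositionalEquality
open import Relation.Nullary using (¬_; yes; no)

≡true⇒T : ∀ {b} → b ≡ true → T b
≡true⇒T refl = tt

T⇒≡true : ∀ {b} → T b → b ≡ true
T⇒≡true {true} _ = refl

¬T⇒≡false : ∀ {b} → ¬ T b → b ≡ false
¬T⇒≡false {true}  ¬b = ⊥-elim (¬b tt)
¬T⇒≡false {false} _  = refl

true≢false : true ≢ false
true≢false ()

∧-true⁻ : ∀ a {b} → a ∧ b ≡ true → a ≡ true × b ≡ true
∧-true⁻ true e = refl , e

∧-true⁺ : ∀ {a b} → a ≡ true → b ≡ true → a ∧ b ≡ true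
∧-true⁺ refl refl = refl

≡-by-truth : ∀ {a b} → (a ≡ true → b ≡ true) → (b ≡ true → a ≡ true) → a ≡ b
≡-by-truth {true}  {true}  _ _ = refl
≡-by-truth {true}  {false} f _ = sym (f refl)
≡-by-truth {false} {true}  _ g = g refl
≡-by-truth {false} {false} _ _ = refl

≤ᵇ-true⁻ : ∀ {a b} → (a ≤ᵇ b) ≡ true → a ≤ b
≤ᵇ-true⁻ e = ≤ᵇ⇒≤ _ _ (≡true⇒T e)

≤ᵇ-true⁺ : ∀ {a b} → a ≤ b → (a ≤ᵇ b) ≡ true
≤ᵇ-true⁺ = T⇒≡true ∘ ≤⇒≤ᵇ

≤ᵇ-false⁺ : ∀ {a b} → b < a → (a ≤ᵇ b) ≡ false
≤ᵇ-false⁺ b<a = ¬T⇒≡false (<⇒≱ b<a ∘ ≤ᵇ⇒≤ _ _)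

<ᵇ-true⁻ : ∀ {a b} → (a <ᵇ b) ≡ true → a < b
<ᵇ-true⁻ e = <ᵇ⇒< _ _ (≡true⇒T e)

<ᵇ-true⁺ : ∀ {a b} → a < b → (a <ᵇ b) ≡ true
<ᵇ-true⁺ = T⇒≡true ∘ <⇒<ᵇ

<ᵇ-false⁺ : ∀ {a b} → b ≤ a → (a <ᵇ b) ≡ false
<ᵇ-false⁺ b≤a = ¬T⇒≡false (λ t → <⇒≱ (<ᵇ⇒< _ _ t) b≤a)

≡ᵇ-true⁻ : ∀ {a b} → (a ≡ᵇ b) ≡ true → a ≡ b
≡ᵇ-true⁻ e = ≡ᵇ⇒≡ _ _ (≡true⇒T e)

≡ᵇ-true⁺ : ∀ {a b} → a ≡ b → (a ≡ᵇ b) ≡ true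
≡ᵇ-true⁺ e = T⇒≡true (≡⇒≡ᵇ _ _ e)

≡ᵇ-false⁺ : ∀ {a b} → a ≢ b → (a ≡ᵇ b) ≡ false
≡ᵇ-false⁺ a≢b = ¬T⇒≡false (a≢b ∘ ≡ᵇ⇒≡ _ _)

-- Counting and finite sums

indicator : Bool → ℕ
indicator true  = 1
indicator false = 0

module _ {A : Set} where

  count-∷ : ∀ (P : A → Bool) x xs → count P (x ∷ xs) ≡ indicator (P x) + count P xs
  count-∷ P x xs with P x
  ... | true  = refl
  ... | false = refl

  count-++ : ∀ (P : A → Bool) xs ys → count P (xs ++ ys) ≡ count P xs + count P ys
  count-++ P xs ys = trans (cong length (filter-++ _ xs ys)) (length-++ (filter _ xs))

  count-≗ : ∀ (P Q : A → Bool) xs → (∀ x → P x ≡ Q x) → count P xs ≡ count Q xs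
  count-≗ P Q []       eq = refl
  count-≗ P Q (x ∷ xs) eq = begin
    count P (x ∷ xs)                     ≡⟨ count-∷ P x xs ⟩
    indicator (P x) + count P xs         ≡⟨ cong₂ _+_ (cong indicator (eq x)) (count-≗ P Q xs eq) ⟩
    indicator (Q x) + count Q xs         ≡⟨ count-∷ Q x xs ⟨
    count Q (x ∷ xs)                     ∎
    where open ≡-Reasoning

  count-none : ∀ (P : A → Bool) xs → All (λ x → P x ≡ false) xs → count P xs ≡ 0
  count-none P []       []       = refl
  count-none P (x ∷ xs) (e ∷ es) = trans (count-∷ P x xs) (cong₂ _+_ (cong indicator e) (count-none P xs es))

  count-never : ∀ (P : A → Bool) xs → (∀ x → P x ≡ false) → count P xs ≡ 0
  count-never P xs never = count-none P xs (All.universal never xs)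

module _ {A B : Set} where

  count-map : ∀ (P : B → Bool) (g : A → B) xs → count P (map g xs) ≡ count (P ∘ g) xs
  count-map P g []       = refl
  count-map P g (x ∷ xs) =
    trans (count-∷ P (g x) (map g xs)) (trans (cong (indicator (P (g x)) +_) (count-map P g xs)) (sym (count-∷ (P ∘ g) x xs)))

  count-concatMap : ∀ (P : B → Bool) (f : A → List B) xs →
    count P (concatMap f xs) ≡ sum (map (count P ∘ f) xs)
  count-concatMap P f []       = refl
  count-concatMap P f (x ∷ xs) = trans (count-++ P (f x) (concatMap f xs)) (cong (count P (f x) +_) (count-concatMap P f xs))


sumBelow : ℕ → (ℕ → ℕ) → ℕ
sumBelow zero    h = 0
sumBelow (suc m) h = h 0 + sumBelow m (h ∘ suc)

sum-map-applyUpTo : ∀ (f g : ℕ → ℕ) m → sum (map f (applyUpTo g m)) ≡ sumBelow m (f ∘ g)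
sum-map-applyUpTo f g zero    = refl
sum-map-applyUpTo f g (suc m) = cong (f (g 0) +_) (sum-map-applyUpTo f (g ∘ suc) m)

sumFromTo≡sumBelow : ∀ a b f → sumFromTo a b f ≡ sumBelow (suc b ∸ a) (λ j → f (a + j))
sumFromTo≡sumBelow a b f = sum-map-applyUpTo (λ j → f (a + j)) (λ x → x) (suc b ∸ a)

sumBelow-+ : ∀ x y h → sumBelow (x + y) h ≡ sumBelow x h + sumBelow y (λ j → h (x + j))
sumBelow-+ zero    y h = refl
sumBelow-+ (suc x) y h = trans (cong (h 0 +_) (sumBelow-+ x y (h ∘ suc))) (sym (+-assoc (h 0) _ _))

sumBelow-cong : ∀ m h g → (∀ j → j < m → h j ≡ g j) → sumBelow m h ≡ sumBelow m g
sumBelow-cong zero    h g eq = refl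
sumBelow-cong (suc m) h g eq =
  cong₂ _+_ (eq 0 (s≤s z≤n)) (sumBelow-cong m (h ∘ suc) (g ∘ suc) (λ j j<m → eq (suc j) (s≤s j<m)))

sumBelow-zero : ∀ m h → (∀ j → j < m → h j ≡ 0) → sumBelow m h ≡ 0
sumBelow-zero zero    h eq = refl
sumBelow-zero (suc m) h eq = cong₂ _+_ (eq 0 (s≤s z≤n)) (sumBelow-zero m (h ∘ suc) (λ j j<m → eq (suc j) (s≤s j<m)))

sumBelow-single : ∀ m h j₀ → j₀ < m → (∀ j → j < m → j ≢ j₀ → h j ≡ 0) → sumBelow m h ≡ h j₀
sumBelow-single (suc m) h zero _ eq =
  trans (cong (h 0 +_) (sumBelow-zero m (h ∘ suc) (λ j j<m → eq (suc j) (s≤s j<m) (λ ())))) (+-identityʳ _)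
sumBelow-single (suc m) h (suc j₀) (s≤s j₀<m) eq =
  trans (cong (_+ sumBelow m (h ∘ suc)) (eq 0 (s≤s z≤n) (λ ())))
    (sumBelow-single m (h ∘ suc) j₀ j₀<m (λ j j<m j≢j₀ → eq (suc j) (s≤s j<m) (j≢j₀ ∘ suc-injective)))

sumBelow-distrib-+ : ∀ m h g → sumBelow m (λ j → h j + g j) ≡ sumBelow m h + sumBelow m g
sumBelow-distrib-+ zero    h g = refl
sumBelow-distrib-+ (suc m) h g =
  trans (cong ((h 0 + g 0) +_) (sumBelow-distrib-+ m (h ∘ suc) (g ∘ suc)))
        (interchange (h 0) (g 0) (sumBelow m (h ∘ suc)) (sumBelow m (g ∘ suc)))

sumBelow-*ˡ : ∀ m c h → sumBelow m (λ j → c * h j) ≡ c * sumBelow m h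
sumBelow-*ˡ zero    c h = sym (*-zeroʳ c)
sumBelow-*ˡ (suc m) c h = trans (cong (c * h 0 +_) (sumBelow-*ˡ m c (h ∘ suc))) (sym (*-distribˡ-+ c (h 0) _))

sumBelow-*ʳ : ∀ m c h → sumBelow m (λ j → h j * c) ≡ sumBelow m h * c
sumBelow-*ʳ zero    c h = refl
sumBelow-*ʳ (suc m) c h = trans (cong (h 0 * c +_) (sumBelow-*ʳ m c (h ∘ suc))) (sym (*-distribʳ-+ c (h 0) _))

count-partition : ∀ {A : Set} (P : A → Bool) (Q : ℕ → A → Bool) a b xs →
  All (λ x → indicator (P x) ≡ sumFromTo a b (λ i → indicator (Q i x))) xs →
  count P xs ≡ sumFromTo a b (λ i → count (Q i) xs)
count-partition P Q a b [] [] =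
  sym (trans (sumFromTo≡sumBelow a b (λ i → count (Q i) [])) (sumBelow-zero (suc b ∸ a) _ (λ _ _ → refl)))
count-partition P Q a b (x ∷ xs) (e ∷ es) = begin
  count P (x ∷ xs)
    ≡⟨ count-∷ P x xs ⟩
  indicator (P x) + count P xs
    ≡⟨ cong₂ _+_ e (count-partition P Q a b xs es) ⟩
  sumFromTo a b (λ i → indicator (Q i x)) + sumFromTo a b (λ i → count (Q i) xs)
    ≡⟨ cong₂ _+_ (sumFromTo≡sumBelow a b (λ i → indicator (Q i x))) (sumFromTo≡sumBelow a b (λ i → count (Q i) xs)) ⟩
  sumBelow (suc b ∸ a) (λ j → indicator (Q (a + j) x)) + sumBelow (suc b ∸ a) (λ j → count (Q (a + j)) xs)
    ≡⟨ sumBelow-distrib-+ (suc b ∸ a) (λ j → indicator (Q (a + j) x)) (λ j → count (Q (a + j)) xs) ⟨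
  sumBelow (suc b ∸ a) (λ j → indicator (Q (a + j) x) + count (Q (a + j)) xs)
    ≡⟨ sumBelow-cong (suc b ∸ a) _ _ (λ j _ → sym (count-∷ (Q (a + j)) x xs)) ⟩
  sumBelow (suc b ∸ a) (λ j → count (Q (a + j)) (x ∷ xs))
    ≡⟨ sumFromTo≡sumBelow a b (λ i → count (Q i) (x ∷ xs)) ⟨
  sumFromTo a b (λ i → count (Q i) (x ∷ xs)) ∎
  where open ≡-Reasoning

sumFromTo-cong : ∀ a b f g → (∀ i → a ≤ i → i ≤ b → f i ≡ g i) → sumFromTo a b f ≡ sumFromTo a b g
sumFromTo-cong a b f g eq = begin
  sumFromTo a b f                        ≡⟨ sumFromTo≡sumBelow a b f ⟩
  sumBelow (suc b ∸ a) (λ j → f (a + j)) ≡⟨ sumBelow-cong (suc b ∸ a) _ _ (λ j j< → eq (a + j) (m≤m+n a j) (inRange j j<)) ⟩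
  sumBelow (suc b ∸ a) (λ j → g (a + j)) ≡⟨ sumFromTo≡sumBelow a b g ⟨
  sumFromTo a b g                        ∎
  where
  open ≡-Reasoning
  inRange : ∀ j → j < suc b ∸ a → a + j ≤ b
  inRange j j< = subst (_≤ b) (+-comm j a) (≤-pred (m≤o∸n⇒m+n≤o (suc j) a≤1+b j<))
    where
    a≤1+b : a ≤ suc b
    a≤1+b = <⇒≤ (m∸n≢0⇒n<m (λ e → n≮0 (subst (j <_) e j<)))

indicator-by-value : ∀ c v a b → (c ≡ true → a < v × v ≤ suc b) →
  indicator c ≡ sumFromTo a b (λ i → indicator (c ∧ (v ≡ᵇ suc i)))
indicator-by-value false v a b _ =
  sym (trans (sumFromTo≡sumBelow a b (λ i → indicator false)) (sumBelow-zero (suc b ∸ a) _ (λ _ _ → refl)))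
indicator-by-value true v a b range with range refl
... | a<v , v≤b+1 with m≤n⇒∃[o]m+o≡n a<v
... | y , refl = sym (begin
  sumFromTo a b (λ i → indicator (suc a + y ≡ᵇ suc i))
    ≡⟨ sumFromTo≡sumBelow a b (λ i → indicator (suc a + y ≡ᵇ suc i)) ⟩
  sumBelow (suc b ∸ a) (λ j → indicator (suc a + y ≡ᵇ suc (a + j)))
    ≡⟨ sumBelow-single (suc b ∸ a) (λ j → indicator (suc a + y ≡ᵇ suc (a + j))) y y< other ⟩
  indicator (suc a + y ≡ᵇ suc (a + y))
    ≡⟨ cong indicator (≡ᵇ-true⁺ {a + y} refl) ⟩
  1 ∎)
  where
  open ≡-Reasoning
  y< : y < suc b ∸ a
  y< = subst (_< suc b ∸ a) (m+n∸m≡n a y) (∸-monoˡ-< v≤b+1 (m≤m+n a y))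
  other : ∀ j → j < suc b ∸ a → j ≢ y → indicator (suc a + y ≡ᵇ suc (a + j)) ≡ 0
  other j _ j≢y = cong indicator (≡ᵇ-false⁺ (j≢y ∘ sym ∘ +-cancelˡ-≡ a _ _ ∘ suc-injective))

-- Preference sets

count-prefSets-suc : ∀ (P : List ℕ → Bool) j m →
  count P (prefSets (suc j) m) ≡ sumBelow m (λ b → count (λ x → P (suc b ∷ x)) (prefSets j m))
count-prefSets-suc P j m = begin
  count P (concatMap (λ a → map (a ∷_) (prefSets j m)) (map suc (upTo m)))
    ≡⟨ count-concatMap P _ (map suc (upTo m)) ⟩
  sum (map (λ a → count P (map (a ∷_) (prefSets j m))) (map suc (upTo m)))
    ≡⟨ cong (λ as → sum (map (λ a → count P (map (a ∷_) (prefSets j m))) as)) (map-applyUpTo (λ x → x) suc m) ⟩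
  sum (map (λ a → count P (map (a ∷_) (prefSets j m))) (applyUpTo suc m))
    ≡⟨ sum-map-applyUpTo _ suc m ⟩
  sumBelow m (λ b → count P (map (suc b ∷_) (prefSets j m)))
    ≡⟨ sumBelow-cong m _ _ (λ b _ → count-map P (suc b ∷_) (prefSets j m)) ⟩
  sumBelow m (λ b → count (λ x → P (suc b ∷ x)) (prefSets j m)) ∎
  where open ≡-Reasoning

prefSets-length : ∀ j m → All (λ x → length x ≡ j) (prefSets j m)
prefSets-length zero    m = refl ∷ []
prefSets-length (suc j) m = concatMap-All (map suc (upTo m))
  where
  concatMap-All : ∀ as → All (λ x → length x ≡ suc j) (concatMap (λ a → map (a ∷_) (prefSets j m)) as)
  concatMap-All []       = []
  concatMap-All (a ∷ as) = ++⁺ (map⁺ (All.map (cong suc) (prefSets-length j m))) (concatMap-All as)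

count-prefSets-head : ∀ (P : List ℕ → Bool) j m h → suc h ≤ m →
  (∀ b x → b ≢ h → P (suc b ∷ x) ≡ false) →
  count P (prefSets (suc j) m) ≡ count (λ x → P (suc h ∷ x)) (prefSets j m)
count-prefSets-head P j m h h<m other =
  trans (count-prefSets-suc P j m)
    (sumBelow-single m _ h h<m (λ b _ b≢h → count-never _ (prefSets j m) (λ x → other b x b≢h)))

count-allLe-prefSets : ∀ t m → t ≤ m → ∀ (P : List ℕ → Bool) j →
  count (λ x → allLe t x ∧ P x) (prefSets j m) ≡ count (λ x → allLe t x ∧ P x) (prefSets j t)
count-allLe-prefSets t m t≤m P zero    = refl
count-allLe-prefSets t m t≤m P (suc j) with m≤n⇒∃[o]m+o≡n t≤m
... | d , refl = begin
  count Pt (prefSets (suc j) (t + d))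
    ≡⟨ count-prefSets-suc Pt j (t + d) ⟩
  sumBelow (t + d) (λ b → count (λ x → Pt (suc b ∷ x)) (prefSets j (t + d)))
    ≡⟨ sumBelow-+ t d _ ⟩
  sumBelow t (λ b → count (λ x → Pt (suc b ∷ x)) (prefSets j (t + d)))
    + sumBelow d (λ b → count (λ x → Pt (suc (t + b) ∷ x)) (prefSets j (t + d)))
    ≡⟨ cong₂ _+_ (sumBelow-cong t _ _ allowed) (sumBelow-zero d _ forbidden) ⟩
  sumBelow t (λ b → count (λ x → Pt (suc b ∷ x)) (prefSets j t)) + 0
    ≡⟨ +-identityʳ _ ⟩
  sumBelow t (λ b → count (λ x → Pt (suc b ∷ x)) (prefSets j t))
    ≡⟨ count-prefSets-suc Pt j t ⟨
  count Pt (prefSets (suc j) t) ∎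
  where
  open ≡-Reasoning
  Pt : List ℕ → Bool
  Pt x = allLe t x ∧ P x
  allowed : ∀ b → b < t →
    count (λ x → Pt (suc b ∷ x)) (prefSets j (t + d)) ≡ count (λ x → Pt (suc b ∷ x)) (prefSets j t)
  allowed b b<t = begin
    count (λ x → Pt (suc b ∷ x)) (prefSets j (t + d))
      ≡⟨ count-≗ _ _ (prefSets j (t + d)) (λ x → cong (λ c → (c ∧ allLe t x) ∧ P (suc b ∷ x)) (≤ᵇ-true⁺ b<t)) ⟩
    count (λ x → allLe t x ∧ P (suc b ∷ x)) (prefSets j (t + d))
      ≡⟨ count-allLe-prefSets t (t + d) t≤m (λ x → P (suc b ∷ x)) j ⟩
    count (λ x → allLe t x ∧ P (suc b ∷ x)) (prefSets j t)
      ≡⟨ count-≗ _ _ (prefSets j t) (λ x → cong (λ c → (c ∧ allLe t x) ∧ P (suc b ∷ x)) (≤ᵇ-true⁺ b<t)) ⟨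
    count (λ x → Pt (suc b ∷ x)) (prefSets j t) ∎
  forbidden : ∀ b → b < d → count (λ x → Pt (suc (t + b) ∷ x)) (prefSets j (t + d)) ≡ 0
  forbidden b _ = count-never _ (prefSets j (t + d))
    (λ x → cong (λ c → (c ∧ allLe t x) ∧ P (suc (t + b) ∷ x)) (≤ᵇ-false⁺ (s≤s (m≤m+n t b))))

-- Parking

park-suc-suc : ∀ a b bs → park (suc (suc a)) (b ∷ bs) ≡ mapᴹ (b ∷_) (park (suc a) bs)
park-suc-suc a b bs with park (suc a) bs
... | just _  = refl
... | nothing = refl

park-1-true : ∀ bs → park 1 (true ∷ bs) ≡ mapᴹ (true ∷_) (park 1 bs)
park-1-true bs with park 1 bs
... | just _  = refl
... | nothing = refl

park-0-true : ∀ bs → park 0 (true ∷ bs) ≡ mapᴹ (true ∷_) (park 0 bs)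
park-0-true bs with park 0 bs
... | just _  = refl
... | nothing = refl

park-0≡park-1 : ∀ bs → park 0 bs ≡ park 1 bs
park-0≡park-1 []           = refl
park-0≡park-1 (false ∷ bs) = refl
park-0≡park-1 (true ∷ bs)  =
  trans (park-0-true bs) (trans (cong (mapᴹ (true ∷_)) (park-0≡park-1 bs)) (sym (park-1-true bs)))

mapᴹ-≡just⁻ : ∀ {f : List Bool → List Bool} m {y} → mapᴹ f m ≡ just y → Σ[ x ∈ List Bool ] m ≡ just x × y ≡ f x
mapᴹ-≡just⁻ (just x) refl = x , refl , refl

data Fills : List Bool → List Bool → Set where
  here  : ∀ bs → Fills (false ∷ bs) (true ∷ bs)
  there : ∀ b {bs bs′} → Fills bs bs′ → Fills (b ∷ bs) (b ∷ bs′)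

park-fills : ∀ a bs {bs′} → park a bs ≡ just bs′ → Fills bs bs′
park-fills a [] ()
park-fills zero       (false ∷ bs) refl = here bs
park-fills (suc zero) (false ∷ bs) refl = here bs
park-fills zero (true ∷ bs) e with mapᴹ-≡just⁻ (park 0 bs) (trans (sym (park-0-true bs)) e)
... | _ , e′ , refl = there true (park-fills 0 bs e′)
park-fills (suc zero) (true ∷ bs) e with mapᴹ-≡just⁻ (park 1 bs) (trans (sym (park-1-true bs)) e)
... | _ , e′ , refl = there true (park-fills 1 bs e′)
park-fills (suc (suc a)) (b ∷ bs) e with mapᴹ-≡just⁻ (park (suc a) bs) (trans (sym (park-suc-suc a b bs)) e)
... | _ , e′ , refl = there b (park-fills (suc a) bs e′)

occupied : List Bool → ℕ
occupied []           = 0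
occupied (true ∷ bs)  = suc (occupied bs)
occupied (false ∷ bs) = occupied bs

isOccupied : ℕ → List Bool → Bool
isOccupied _       []       = false
isOccupied zero    (b ∷ _)  = b
isOccupied (suc j) (_ ∷ bs) = isOccupied j bs

Fills-length : ∀ {bs bs′} → Fills bs bs′ → length bs′ ≡ length bs
Fills-length (here _)    = refl
Fills-length (there _ f) = cong suc (Fills-length f)

Fills-occupied : ∀ {bs bs′} → Fills bs bs′ → occupied bs′ ≡ suc (occupied bs)
Fills-occupied (here _)        = refl
Fills-occupied (there true f)  = cong suc (Fills-occupied f)
Fills-occupied (there false f) = Fills-occupied f

Fills-isOccupied : ∀ {bs bs′} → Fills bs bs′ → ∀ j → isOccupied j bs ≡ true → isOccupied j bs′ ≡ true
Fills-isOccupied (here _)    zero    ()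
Fills-isOccupied (here _)    (suc j) o = o
Fills-isOccupied (there _ f) zero    o = o
Fills-isOccupied (there _ f) (suc j) o = Fills-isOccupied f j o

run-length : ∀ occ α → length (proj₁ (run occ α)) ≡ length occ
run-length occ []      = refl
run-length occ (a ∷ α) with park a occ in eq
... | just occ′ = trans (run-length occ′ α) (Fills-length (park-fills a occ eq))
... | nothing   = run-length occ α

run-occupied : ∀ occ α → occupied (proj₁ (run occ α)) + proj₂ (run occ α) ≡ occupied occ + length α
run-occupied occ []      = refl
run-occupied occ (a ∷ α) with park a occ in eq
... | just occ′ = begin
  occupied (proj₁ (run occ′ α)) + proj₂ (run occ′ α) ≡⟨ run-occupied occ′ α ⟩
  occupied occ′ + length α                            ≡⟨ cong (_+ length α) (Fills-occupied (park-fills a occ eq)) ⟩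
  suc (occupied occ) + length α                       ≡⟨ +-suc (occupied occ) (length α) ⟨
  occupied occ + suc (length α)                       ∎
  where open ≡-Reasoning
... | nothing = begin
  occupied (proj₁ (run occ α)) + suc (proj₂ (run occ α)) ≡⟨ +-suc _ _ ⟩
  suc (occupied (proj₁ (run occ α)) + proj₂ (run occ α)) ≡⟨ cong suc (run-occupied occ α) ⟩
  suc (occupied occ + length α)                          ≡⟨ +-suc (occupied occ) (length α) ⟨
  occupied occ + suc (length α)                          ∎
  where open ≡-Reasoning

run-isOccupied : ∀ occ α j → isOccupied j occ ≡ true → isOccupied j (proj₁ (run occ α)) ≡ true
run-isOccupied occ []      j o = o
run-isOccupied occ (a ∷ α) j o with park a occ in eq
... | just occ′ = run-isOccupied occ′ α j (Fills-isOccupied (park-fills a occ eq) j o)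
... | nothing   = run-isOccupied occ α j o

isOccupied-middle : ∀ A b B → isOccupied (length A) (A ++ b ∷ B) ≡ b
isOccupied-middle []      b B = refl
isOccupied-middle (_ ∷ A) b B = isOccupied-middle A b B

continueInto : List Bool → List Bool → Maybe (List Bool) → Maybe (List Bool)
continueInto A E (just A′) = just (A′ ++ E)
continueInto A E nothing   = mapᴹ (A ++_) (park 1 E)

continueInto-∷ : ∀ b A E r → mapᴹ (b ∷_) (continueInto A E r) ≡ continueInto (b ∷ A) E (mapᴹ (b ∷_) r)
continueInto-∷ b A E (just _) = refl
continueInto-∷ b A E nothing  = sym (mapᴹ-∘ (park 1 E))

park-++-within : ∀ a A E → a ≤ length A → park a (A ++ E) ≡ continueInto A E (park a A)
park-++-within zero [] E z≤n = trans (park-0≡park-1 E) (sym (mapᴹ-id _))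
park-++-within zero       (false ∷ A) E _ = refl
park-++-within (suc zero) (false ∷ A) E _ = refl
park-++-within zero (true ∷ A) E _ = begin
  park 0 (true ∷ (A ++ E))                     ≡⟨ park-0-true (A ++ E) ⟩
  mapᴹ (true ∷_) (park 0 (A ++ E))             ≡⟨ cong (mapᴹ (true ∷_)) (park-++-within zero A E z≤n) ⟩
  mapᴹ (true ∷_) (continueInto A E (park 0 A)) ≡⟨ continueInto-∷ true A E (park 0 A) ⟩
  continueInto (true ∷ A) E (mapᴹ (true ∷_) (park 0 A)) ≡⟨ cong (continueInto (true ∷ A) E) (park-0-true A) ⟨
  continueInto (true ∷ A) E (park 0 (true ∷ A)) ∎
  where open ≡-Reasoning
park-++-within (suc zero) (true ∷ A) E _ = begin
  park 1 (true ∷ (A ++ E))                     ≡⟨ park-1-true (A ++ E) ⟩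
  mapᴹ (true ∷_) (park 1 (A ++ E))             ≡⟨ cong (mapᴹ (true ∷_)) (park-0≡park-1 (A ++ E)) ⟨
  mapᴹ (true ∷_) (park 0 (A ++ E))             ≡⟨ cong (mapᴹ (true ∷_)) (park-++-within zero A E z≤n) ⟩
  mapᴹ (true ∷_) (continueInto A E (park 0 A)) ≡⟨ continueInto-∷ true A E (park 0 A) ⟩
  continueInto (true ∷ A) E (mapᴹ (true ∷_) (park 0 A))
    ≡⟨ cong (λ r → continueInto (true ∷ A) E (mapᴹ (true ∷_) r)) (park-0≡park-1 A) ⟩
  continueInto (true ∷ A) E (mapᴹ (true ∷_) (park 1 A)) ≡⟨ cong (continueInto (true ∷ A) E) (park-1-true A) ⟨
  continueInto (true ∷ A) E (park 1 (true ∷ A)) ∎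
  where open ≡-Reasoning
park-++-within (suc (suc a)) (b ∷ A) E (s≤s a≤A) = begin
  park (suc (suc a)) (b ∷ (A ++ E))                  ≡⟨ park-suc-suc a b (A ++ E) ⟩
  mapᴹ (b ∷_) (park (suc a) (A ++ E))                ≡⟨ cong (mapᴹ (b ∷_)) (park-++-within (suc a) A E a≤A) ⟩
  mapᴹ (b ∷_) (continueInto A E (park (suc a) A))    ≡⟨ continueInto-∷ b A E (park (suc a) A) ⟩
  continueInto (b ∷ A) E (mapᴹ (b ∷_) (park (suc a) A)) ≡⟨ cong (continueInto (b ∷ A) E) (park-suc-suc a b A) ⟨
  continueInto (b ∷ A) E (park (suc (suc a)) (b ∷ A)) ∎
  where open ≡-Reasoning

park-++-beyond : ∀ a A E → length A < a → park a (A ++ E) ≡ mapᴹ (A ++_) (park (a ∸ length A) E)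
park-++-beyond a [] E _ = sym (mapᴹ-id _)
park-++-beyond (suc (suc a)) (b ∷ A) E (s≤s A<a) = begin
  park (suc (suc a)) (b ∷ (A ++ E))                        ≡⟨ park-suc-suc a b (A ++ E) ⟩
  mapᴹ (b ∷_) (park (suc a) (A ++ E))                      ≡⟨ cong (mapᴹ (b ∷_)) (park-++-beyond (suc a) A E A<a) ⟩
  mapᴹ (b ∷_) (mapᴹ (A ++_) (park (suc a ∸ length A) E))   ≡⟨ mapᴹ-∘ (park (suc a ∸ length A) E) ⟨
  mapᴹ ((b ∷ A) ++_) (park (suc a ∸ length A) E)           ∎
  where open ≡-Reasoning

park-at-free : ∀ A B → park (suc (length A)) (A ++ false ∷ B) ≡ just (A ++ true ∷ B)
park-at-free A B =
  trans (park-++-beyond (suc (length A)) A (false ∷ B) ≤-refl)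
    (cong (λ a → mapᴹ (A ++_) (park a (false ∷ B))) (trans (cong (_∸ length A) (+-comm 1 (length A))) (m+n∸m≡n (length A) 1)))

park-past-free : ∀ A B a → suc (length A) < a →
  park a (A ++ false ∷ B) ≡ mapᴹ (λ B′ → A ++ false ∷ B′) (park (a ∸ suc (length A)) B)
park-past-free A B a A+1<a with m≤n⇒∃[o]m+o≡n A+1<a
... | d , refl = begin
  park (2 + length A + d) (A ++ false ∷ B)
    ≡⟨ park-++-beyond _ A (false ∷ B) (≤-trans (n≤1+n _) (m≤m+n _ d)) ⟩
  mapᴹ (A ++_) (park (2 + length A + d ∸ length A) (false ∷ B))
    ≡⟨ cong (λ a → mapᴹ (A ++_) (park a (false ∷ B))) (shift (length A) 2) ⟩
  mapᴹ (A ++_) (park (suc (suc d)) (false ∷ B))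
    ≡⟨ cong (mapᴹ (A ++_)) (park-suc-suc d false B) ⟩
  mapᴹ (A ++_) (mapᴹ (false ∷_) (park (suc d) B))
    ≡⟨ mapᴹ-∘ (park (suc d) B) ⟨
  mapᴹ (λ B′ → A ++ false ∷ B′) (park (suc d) B)
    ≡⟨ cong (λ a → mapᴹ (λ B′ → A ++ false ∷ B′) (park a B)) (shift (suc (length A)) 1) ⟨
  mapᴹ (λ B′ → A ++ false ∷ B′) (park (2 + length A + d ∸ suc (length A)) B) ∎
  where
  open ≡-Reasoning
  shift : ∀ x c → c + x + d ∸ x ≡ c + d
  shift x c = trans (cong (_∸ x) (trans (cong (_+ d) (+-comm c x)) (+-assoc x c d))) (m+n∸m≡n x (c + d))

-- Splitting a preference set at the value i + 1

lows : ℕ → List ℕ → List ℕ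
lows i []      = []
lows i (a ∷ α) = if a ≤ᵇ i then a ∷ lows i α else lows i α

highs : ℕ → List ℕ → List ℕ
highs i []      = []
highs i (a ∷ α) = if suc i <ᵇ a then (a ∸ suc i) ∷ highs i α else highs i α

skips : ℕ → List ℕ → Bool
skips i []      = true
skips i (a ∷ α) = not (a ≡ᵇ suc i) ∧ skips i α

data Position (i a : ℕ) : Set where
  low  : a ≤ i → Position i a
  gap  : a ≡ suc i → Position i a
  high : suc i < a → Position i a

position : ∀ i a → Position i a
position i a with <-cmp a (suc i)
... | tri< a<i+1 _ _ = low (≤-pred a<i+1)
... | tri≈ _ a≡i+1 _ = gap a≡i+1
... | tri> _ _ i+1<a = high i+1<a

skips-gap : ∀ i α → skips i (suc i ∷ α) ≡ false
skips-gap i α rewrite ≡ᵇ-true⁺ {suc i} refl = refl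

module _ {i a : ℕ} (α : List ℕ) where

  highs-high : suc i < a → highs i (a ∷ α) ≡ (a ∸ suc i) ∷ highs i α
  highs-high i+1<a rewrite <ᵇ-true⁺ i+1<a = refl

  highs-notHigh : a ≤ suc i → highs i (a ∷ α) ≡ highs i α
  highs-notHigh a≤i+1 rewrite <ᵇ-false⁺ a≤i+1 = refl

  private
    lows-low : a ≤ i → lows i (a ∷ α) ≡ a ∷ lows i α
    lows-low a≤i rewrite ≤ᵇ-true⁺ a≤i = refl

    lows-notLow : i < a → lows i (a ∷ α) ≡ lows i α
    lows-notLow i<a rewrite ≤ᵇ-false⁺ i<a = refl

    skips-∷ : a ≢ suc i → skips i (a ∷ α) ≡ skips i α
    skips-∷ a≢i+1 rewrite ≡ᵇ-false⁺ a≢i+1 = refl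

  low-∷ : a ≤ i → lows i (a ∷ α) ≡ a ∷ lows i α × highs i (a ∷ α) ≡ highs i α × skips i (a ∷ α) ≡ skips i α
  low-∷ a≤i = lows-low a≤i , highs-notHigh (m≤n⇒m≤1+n a≤i) , skips-∷ (<⇒≢ (s≤s a≤i))

  high-∷ : suc i < a → lows i (a ∷ α) ≡ lows i α × highs i (a ∷ α) ≡ (a ∸ suc i) ∷ highs i α × skips i (a ∷ α) ≡ skips i α
  high-∷ i+1<a = lows-notLow (<-trans (n<1+n i) i+1<a) , highs-high i+1<a , skips-∷ (>⇒≢ i+1<a)

continueRun : List Bool → Maybe (List Bool) → List ℕ → List Bool × ℕ
continueRun occ (just occ′) α = run occ′ α
continueRun occ nothing     α = proj₁ (run occ α) , suc (proj₂ (run occ α))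

run-∷ : ∀ occ a α → run occ (a ∷ α) ≡ continueRun occ (park a occ) α
run-∷ occ a α with park a occ
... | just _  = refl
... | nothing = refl

module _ (i : ℕ) where

  run-split : ∀ α A B → length A ≡ i → skips i α ≡ true → proj₂ (run A (lows i α)) ≡ 0 →
    run (A ++ false ∷ B) α ≡ (proj₁ (run A (lows i α)) ++ false ∷ proj₁ (run B (highs i α)) , proj₂ (run B (highs i α)))
  run-split []      A B _ _ _ = refl
  run-split (a ∷ α) A B |A| skip noFail with position i a
  ... | gap refl = ⊥-elim (true≢false (trans (sym skip) (skips-gap i α)))
  ... | low a≤i with low-∷ α a≤i
  ...   | eL , eH , eS rewrite eL | eH | eS | run-∷ A a (lows i α) | run-∷ (A ++ false ∷ B) a α
          | park-++-within a A (false ∷ B) (subst (a ≤_) (sym |A|) a≤i) with park a A in eq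
  ...     | just A′ = run-split α A′ B (trans (Fills-length (park-fills a A eq)) |A|) skip noFail
  ...     | nothing = ⊥-elim (1+n≢0 noFail)
  run-split (a ∷ α) A B |A| skip noFail | high i+1<a with high-∷ α i+1<a
  ...   | eL , eH , eS rewrite eL | eH | eS | run-∷ (A ++ false ∷ B) a α | run-∷ B (a ∸ suc i) (highs i α)
          | park-past-free A B a (subst (λ n → suc n < a) (sym |A|) i+1<a) | |A| with park (a ∸ suc i) B
  ...     | just B′ = run-split α A B′ |A| skip noFail
  ...     | nothing rewrite run-split α A B |A| skip noFail = refl

  occupied⇒not-free-after-run : ∀ S α A′ B′ → length A′ ≡ i → isOccupied i S ≡ true → proj₁ (run S α) ≢ A′ ++ false ∷ B′
  occupied⇒not-free-after-run S α A′ B′ |A′| occ final = true≢false (begin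
    true                                  ≡⟨ run-isOccupied S α i occ ⟨
    isOccupied i (proj₁ (run S α))        ≡⟨ cong (isOccupied i) final ⟩
    isOccupied i (A′ ++ false ∷ B′)       ≡⟨ cong (λ j → isOccupied j (A′ ++ false ∷ B′)) |A′| ⟨
    isOccupied (length A′) (A′ ++ false ∷ B′) ≡⟨ isOccupied-middle A′ false B′ ⟩
    false                                 ∎)
    where open ≡-Reasoning

  isOccupied-filled : ∀ A B → length A ≡ i → isOccupied i (A ++ true ∷ B) ≡ true
  isOccupied-filled A B refl = isOccupied-middle A true B

  free-after-run⇒split : ∀ α A B A′ B′ → length A ≡ i → length A′ ≡ i →
    proj₁ (run (A ++ false ∷ B) α) ≡ A′ ++ false ∷ B′ →
    skips i α ≡ true × proj₂ (run A (lows i α)) ≡ 0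
  free-after-run⇒split []      A B A′ B′ _ _ _ = refl , refl
  free-after-run⇒split (a ∷ α) A B A′ B′ |A| |A′| final with position i a
  ... | gap refl rewrite run-∷ (A ++ false ∷ B) (suc i) α
        | subst (λ n → park (suc n) (A ++ false ∷ B) ≡ just (A ++ true ∷ B)) |A| (park-at-free A B) =
        ⊥-elim (occupied⇒not-free-after-run (A ++ true ∷ B) α A′ B′ |A′| (isOccupied-filled A B |A|) final)
  ... | low a≤i with low-∷ α a≤i
  ...   | eL , _ , eS rewrite eL | eS | run-∷ A a (lows i α) | run-∷ (A ++ false ∷ B) a α
          | park-++-within a A (false ∷ B) (subst (a ≤_) (sym |A|) a≤i) with park a A in eq
  ...     | just A₁ = free-after-run⇒split α A₁ B A′ B′ (trans (Fills-length (park-fills a A eq)) |A|) |A′| final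
  ...     | nothing = ⊥-elim (occupied⇒not-free-after-run (A ++ true ∷ B) α A′ B′ |A′| (isOccupied-filled A B |A|) final)
  free-after-run⇒split (a ∷ α) A B A′ B′ |A| |A′| final | high i+1<a with high-∷ α i+1<a
  ...   | eL , _ , eS rewrite eL | eS | run-∷ (A ++ false ∷ B) a α
          | park-past-free A B a (subst (λ n → suc n < a) (sym |A|) i+1<a) | |A| with park (a ∸ suc i) B
  ...     | just B₁ = free-after-run⇒split α A B₁ A′ B′ |A| |A′| final
  ...     | nothing = free-after-run⇒split α A B A′ B′ |A| |A′| final

lastFreeFrom-full : ∀ j F → and F ≡ true → lastFreeFrom j F ≡ 0
lastFreeFrom-full j []         _    = refl
lastFreeFrom-full j (true ∷ F) full rewrite lastFreeFrom-full (suc j) F full = refl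

lastFreeFrom≡0⇒full : ∀ j F → lastFreeFrom (suc j) F ≡ 0 → and F ≡ true
lastFreeFrom≡0⇒full j []      _ = refl
lastFreeFrom≡0⇒full j (b ∷ F) e with lastFreeFrom (suc (suc j)) F in e′
lastFreeFrom≡0⇒full j (true ∷ F) e | zero = lastFreeFrom≡0⇒full (suc j) F e′

lastFreeFrom-last : ∀ j A B → and B ≡ true → lastFreeFrom (suc j) (A ++ false ∷ B) ≡ suc (j + length A)
lastFreeFrom-last j [] B full rewrite lastFreeFrom-full (suc (suc j)) B full = cong suc (sym (+-identityʳ j))
lastFreeFrom-last j (b ∷ A) B full rewrite lastFreeFrom-last (suc j) A B full = cong suc (sym (+-suc j (length A)))

lastFreeFrom≡suc⁻ : ∀ j F m → lastFreeFrom (suc j) F ≡ suc m →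
  Σ[ A ∈ List Bool ] Σ[ B ∈ List Bool ] F ≡ A ++ false ∷ B × j + length A ≡ m × and B ≡ true
lastFreeFrom≡suc⁻ j (b ∷ F) m e with lastFreeFrom (suc (suc j)) F in e′
lastFreeFrom≡suc⁻ j (false ∷ F) m refl | zero = [] , F , refl , +-identityʳ j , lastFreeFrom≡0⇒full (suc j) F e′
lastFreeFrom≡suc⁻ j (b ∷ F) m refl | suc m′ with lastFreeFrom≡suc⁻ (suc j) F m′ e′
... | A , B , refl , j+A≡m , full = b ∷ A , B , refl , trans (+-suc j (length A)) j+A≡m , full

++-∷-injectiveʳ : ∀ {A : Set} (xs ys : List A) {x y : A} {xs′ ys′} →
  xs ++ x ∷ xs′ ≡ ys ++ y ∷ ys′ → length xs ≡ length ys → xs′ ≡ ys′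
++-∷-injectiveʳ []       []       refl _ = refl
++-∷-injectiveʳ (_ ∷ xs) (_ ∷ ys) eq   |xs|≡|ys| = ++-∷-injectiveʳ xs ys (∷-injectiveʳ eq) (suc-injective |xs|≡|ys|)

module _ (i : ℕ) (α : List ℕ) (A B : List Bool) (|A| : length A ≡ i) where

  private
    left  = run A (lows i α)
    right = run B (highs i α)
    whole = run (A ++ false ∷ B) α

  |left| : length (proj₁ left) ≡ i
  |left| = trans (run-length A (lows i α)) |A|

  lastFree≡suc⇐ : skips i α ≡ true → proj₂ left ≡ 0 → and (proj₁ right) ≡ true →
    proj₂ whole ≡ proj₂ right × lastFree (proj₁ whole) ≡ suc i
  lastFree≡suc⇐ skip noFail full rewrite run-split i α A B |A| skip noFail =
    refl , trans (lastFreeFrom-last 0 (proj₁ left) (proj₁ right) full) (cong suc |left|)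

  lastFree≡suc⇒ : lastFree (proj₁ whole) ≡ suc i →
    skips i α ≡ true × proj₂ left ≡ 0 × proj₂ whole ≡ proj₂ right × and (proj₁ right) ≡ true
  lastFree≡suc⇒ last with lastFreeFrom≡suc⁻ 0 (proj₁ whole) i last
  ... | A′ , B′ , final , |A′| , full with free-after-run⇒split i α A B A′ B′ |A| |A′| final
  ... | skip , noFail = skip , noFail , cong proj₂ split , subst (λ F → and F ≡ true) B′≡right full
    where
    split = run-split i α A B |A| skip noFail
    B′≡right : B′ ≡ proj₁ right
    B′≡right = ++-∷-injectiveʳ A′ (proj₁ left) (trans (sym final) (cong proj₁ split)) (trans |A′| (sym |left|))

-- Extra free spaces at the end of the lot

replicate-+ : ∀ {A : Set} a b (x : A) → replicate (a + b) x ≡ replicate a x ++ replicate b x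
replicate-+ zero    b x = refl
replicate-+ (suc a) b x = cong (x ∷_) (replicate-+ a b x)

park-1-past-occupied : ∀ j X → park 1 (replicate j true ++ false ∷ X) ≡ just (true ∷ (replicate j true ++ X))
park-1-past-occupied zero    X = refl
park-1-past-occupied (suc j) X rewrite park-1-true (replicate j true ++ false ∷ X) | park-1-past-occupied j X = refl

park-1-occupied : ∀ j → park 1 (replicate j true ++ []) ≡ nothing
park-1-occupied zero    = refl
park-1-occupied (suc j) rewrite park-1-true (replicate j true ++ []) | park-1-occupied j = refl

-- Cars that fail in S take the c extra free spaces in order of arrival, after j already taken ones.
run-++-free : ∀ β S j c → allLe (length S) β ≡ true →
  run (S ++ replicate j true ++ replicate c false) β ≡
    (proj₁ (run S β) ++ replicate (j + (proj₂ (run S β) ⊓ c)) true ++ replicate (c ∸ proj₂ (run S β)) false ,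
     proj₂ (run S β) ∸ c)
run-++-free [] S j c _ rewrite 0∸n≡0 c | +-identityʳ j = refl
run-++-free (a ∷ β) S j c β≤S with ∧-true⁻ (a ≤ᵇ length S) β≤S
... | a≤S , β≤S′ rewrite run-∷ (S ++ replicate j true ++ replicate c false) a β | run-∷ S a β
      | park-++-within a S (replicate j true ++ replicate c false) (≤ᵇ-true⁻ a≤S) with park a S in eq
...   | just S′ = run-++-free β S′ j c (subst (λ m → allLe m β ≡ true) (sym (Fills-length (park-fills a S eq))) β≤S′)
run-++-free (a ∷ β) S j zero _ | _ , β≤S′ | nothing
  rewrite park-1-occupied j | run-++-free β S j zero β≤S′ | ⊓-zeroʳ (proj₂ (run S β)) | 0∸n≡0 (proj₂ (run S β)) = refl
run-++-free (a ∷ β) S j (suc c) _ | _ , β≤S′ | nothing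
  rewrite park-1-past-occupied j (replicate c false) | run-++-free β S (suc j) c β≤S′ | +-suc j (proj₂ (run S β) ⊓ c) = refl

flaws-+ : ∀ r k β → allLe r β ≡ true → flaws (r + k) β ≡ flaws r β ∸ k
flaws-+ r k β β≤r rewrite replicate-+ r k false =
  cong proj₂ (run-++-free β (replicate r false) 0 k (subst (λ m → allLe m β ≡ true) (sym (length-replicate r)) β≤r))

occupied≤length : ∀ F → occupied F ≤ length F
occupied≤length []          = z≤n
occupied≤length (true ∷ F)  = s≤s (occupied≤length F)
occupied≤length (false ∷ F) = m≤n⇒m≤1+n (occupied≤length F)

occupied≡length⇒full : ∀ F → occupied F ≡ length F → and F ≡ true
occupied≡length⇒full []          _ = refl
occupied≡length⇒full (true ∷ F)  e = occupied≡length⇒full F (suc-injective e)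
occupied≡length⇒full (false ∷ F) e = ⊥-elim (<⇒≢ (s≤s (occupied≤length F)) e)

full⇒occupied≡length : ∀ F → and F ≡ true → occupied F ≡ length F
full⇒occupied≡length []         _    = refl
full⇒occupied≡length (true ∷ F) full = cong suc (full⇒occupied≡length F full)

occupied-empty : ∀ r → occupied (replicate r false) ≡ 0
occupied-empty zero    = refl
occupied-empty (suc r) = occupied-empty r

occupied+flaws : ∀ m α → occupied (finalOcc m α) + flaws m α ≡ length α
occupied+flaws m α = trans (run-occupied (replicate m false) α) (cong (_+ length α) (occupied-empty m))

|finalOcc| : ∀ m α → length (finalOcc m α) ≡ m
|finalOcc| m α = trans (run-length (replicate m false) α) (length-replicate m)

+-≤-≤-equal : ∀ {a b c d} → a ≤ c → b ≤ d → a + b ≡ c + d → a ≡ c × b ≡ d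
+-≤-≤-equal {a} {b} {c} {d} a≤c b≤d eq with m≤n⇒m<n∨m≡n a≤c
... | inj₂ refl = refl , +-cancelˡ-≡ a b d eq
... | inj₁ a<c  = ⊥-elim (<-irrefl eq (+-mono-<-≤ a<c b≤d))

module _ (r k : ℕ) (β : List ℕ) (β≤r : allLe r β ≡ true) (|β| : length β ≡ r + k) where

  flaws≡⇒parks : flaws r β ≡ k → flaws (r + k) β ≡ 0
  flaws≡⇒parks flaws≡k = trans (flaws-+ r k β β≤r) (trans (cong (_∸ k) flaws≡k) (n∸n≡0 k))

  parks⇒flaws≡ : flaws (r + k) β ≡ 0 → flaws r β ≡ k × and (finalOcc r β) ≡ true
  parks⇒flaws≡ parks with +-≤-≤-equal (≤-trans (occupied≤length (finalOcc r β)) (≤-reflexive (|finalOcc| r β)))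
                                       (m∸n≡0⇒m≤n (trans (sym (flaws-+ r k β β≤r)) parks))
                                       (trans (occupied+flaws r β) |β|)
  ... | occ≡r , flaws≡k = flaws≡k , occupied≡length⇒full (finalOcc r β) (trans occ≡r (sym (|finalOcc| r β)))

-- Preference sets whose last free space is i + 1

lows-highs-length : ∀ i α → skips i α ≡ true → length (lows i α) + length (highs i α) ≡ length α
lows-highs-length i []      _    = refl
lows-highs-length i (a ∷ α) skip with position i a
... | gap refl = ⊥-elim (true≢false (trans (sym skip) (skips-gap i α)))
... | low a≤i with low-∷ α a≤i
...   | eL , eH , eS rewrite eL | eH | eS = cong suc (lows-highs-length i α skip)
lows-highs-length i (a ∷ α) skip | high i+1<a with high-∷ α i+1<a
...   | eL , eH , eS rewrite eL | eH | eS = trans (+-suc _ _) (cong suc (lows-highs-length i α skip))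

module _ (a y r k i : ℕ) (a+y≡n : a + y ≡ i + suc r) where

  private
    rearrange : ∀ a r k → a + (r + k) ≡ (a + k) + r
    rearrange = solve-∀

  balance⇐ : y ≡ r + k → a + k ≡ suc i
  balance⇐ refl = +-cancelʳ-≡ r _ _ (trans (sym (rearrange a r k)) (trans a+y≡n (+-suc i r)))

  balance⇒ : a + k ≡ suc i → y ≡ r + k
  balance⇒ a+k≡1+i = +-cancelˡ-≡ a _ _ (begin
    a + y        ≡⟨ a+y≡n ⟩
    i + suc r    ≡⟨ +-suc i r ⟩
    suc i + r    ≡⟨ cong (_+ r) a+k≡1+i ⟨
    (a + k) + r  ≡⟨ rearrange a r k ⟨
    a + (r + k)  ∎)
    where open ≡-Reasoning

module _ {n : ℕ} (i r k : ℕ) (n≡i+1+r : n ≡ i + suc r) (α : List ℕ) (|α| : length α ≡ n)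
         (highs≤r : allLe r (highs i α) ≡ true) where

  private
    L = lows i α
    H = highs i α

    lot : replicate n false ≡ replicate i false ++ false ∷ replicate r false
    lot = trans (cong (λ m → replicate m false) n≡i+1+r) (replicate-+ i (suc r) false)

    lastFree′ : ∀ α → mα n α ≡ lastFree (proj₁ (run (replicate i false ++ false ∷ replicate r false) α))
    lastFree′ α = cong (λ S → lastFree (proj₁ (run S α))) lot

    flaws′ : ∀ α → flaws n α ≡ proj₂ (run (replicate i false ++ false ∷ replicate r false) α)
    flaws′ α = cong (λ S → proj₂ (run S α)) lot

    |H|≡ : skips i α ≡ true → length L + length H ≡ i + suc r
    |H|≡ skip = trans (lows-highs-length i α skip) (trans |α| n≡i+1+r)

  lastFree-gap⇒ : flaws n α ≡ k → mα n α ≡ suc i →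
    skips i α ≡ true × flaws i L ≡ 0 × length L + k ≡ suc i × flaws (r + k) H ≡ 0
  lastFree-gap⇒ flaws≡k last
    with lastFree≡suc⇒ i α (replicate i false) (replicate r false) (length-replicate i) (trans (sym (lastFree′ α)) last)
  ... | skip , noFail , whole≡right , full =
    skip , noFail , balance⇐ _ _ r k i (|H|≡ skip) |H|≡r+k , flaws≡⇒parks r k H highs≤r |H|≡r+k rightFlaws
    where
    rightFlaws : flaws r H ≡ k
    rightFlaws = trans (sym whole≡right) (trans (sym (flaws′ α)) flaws≡k)
    |H|≡r+k : length H ≡ r + k
    |H|≡r+k = begin
      length H                            ≡⟨ occupied+flaws r H ⟨
      occupied (finalOcc r H) + flaws r H ≡⟨ cong (_+ flaws r H) (full⇒occupied≡length (finalOcc r H) full) ⟩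
      length (finalOcc r H) + flaws r H   ≡⟨ cong₂ _+_ (|finalOcc| r H) rightFlaws ⟩
      r + k                               ∎
      where open ≡-Reasoning

  lastFree-gap⇐ : skips i α ≡ true → flaws i L ≡ 0 → length L + k ≡ suc i → flaws (r + k) H ≡ 0 →
    flaws n α ≡ k × mα n α ≡ suc i
  lastFree-gap⇐ skip noFail |L|+k≡1+i parks with parks⇒flaws≡ r k H highs≤r (balance⇒ _ _ r k i (|H|≡ skip) |L|+k≡1+i) parks
  ... | rightFlaws , full with lastFree≡suc⇐ i α (replicate i false) (replicate r false) (length-replicate i) skip noFail full
  ... | whole≡right , last = trans (flaws′ α) (trans whole≡right rightFlaws) , trans (lastFree′ α) last

allLe-mono : ∀ {t t′} β → t ≤ t′ → allLe t β ≡ true → allLe t′ β ≡ true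
allLe-mono []      t≤t′ _   = refl
allLe-mono {t} (a ∷ β) t≤t′ a∷β≤t with ∧-true⁻ (a ≤ᵇ t) a∷β≤t
... | a≤t , β≤t = ∧-true⁺ (≤ᵇ-true⁺ (≤-trans (≤ᵇ-true⁻ {a} a≤t) t≤t′)) (allLe-mono β t≤t′ β≤t)

lows-allLe : ∀ i α → allLe i (lows i α) ≡ true
lows-allLe i []      = refl
lows-allLe i (a ∷ α) with a ≤ᵇ i in a≤i
... | true  rewrite a≤i = lows-allLe i α
... | false = lows-allLe i α

≤ᵇ-∸ : ∀ a s c → c < a → (a ≤ᵇ s) ≡ (a ∸ c ≤ᵇ s ∸ c)
≤ᵇ-∸ a s c c<a = ≡-by-truth (≤ᵇ-true⁺ ∘ ∸-monoˡ-≤ c ∘ ≤ᵇ-true⁻) (≤ᵇ-true⁺ ∘ shiftBack ∘ ≤ᵇ-true⁻)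
  where
  shiftBack : a ∸ c ≤ s ∸ c → a ≤ s
  shiftBack a∸c≤s∸c with c ≤? s
  ... | yes c≤s = begin
    a          ≡⟨ m∸n+n≡m (<⇒≤ c<a) ⟨
    a ∸ c + c  ≤⟨ +-monoˡ-≤ c a∸c≤s∸c ⟩
    s ∸ c + c  ≡⟨ m∸n+n≡m c≤s ⟩
    s          ∎
    where open ≤-Reasoning
  ... | no c≰s = ⊥-elim (<⇒≱ (m<n⇒0<n∸m c<a) (≤-trans a∸c≤s∸c (≤-reflexive (m≤n⇒m∸n≡0 (<⇒≤ (≰⇒> c≰s))))))

allLe-highs : ∀ i s α → i < s → allLe s α ≡ allLe (s ∸ suc i) (highs i α)
allLe-highs i s []      _   = refl
allLe-highs i s (a ∷ α) i<s with position i a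
... | gap refl rewrite highs-notHigh {i} {suc i} α ≤-refl | ≤ᵇ-true⁺ i<s = allLe-highs i s α i<s
... | low a≤i rewrite highs-notHigh α (m≤n⇒m≤1+n a≤i) | ≤ᵇ-true⁺ {a} {s} (≤-trans a≤i (<⇒≤ i<s)) = allLe-highs i s α i<s
... | high i+1<a rewrite highs-high α i+1<a = cong₂ _∧_ (≤ᵇ-∸ a s (suc i) i+1<a) (allLe-highs i s α i<s)

-- Interleaving low and high preferences

splitsAs : ℕ → ℕ → (List ℕ → Bool) → (List ℕ → Bool) → List ℕ → Bool
splitsAs i p PL PR α = skips i α ∧ ((length (lows i α) ≡ᵇ p) ∧ (PL (lows i α) ∧ PR (highs i α)))

splitsAs-parts : ∀ i p PL PR α → splitsAs i p PL PR α ≡ true →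
  skips i α ≡ true × length (lows i α) ≡ p × PL (lows i α) ≡ true × PR (highs i α) ≡ true
splitsAs-parts i p PL PR α splits with ∧-true⁻ (skips i α) splits
... | skip , rest with ∧-true⁻ (length (lows i α) ≡ᵇ p) rest
... | |L|≡p , rest′ with ∧-true⁻ (PL (lows i α)) rest′
... | L-ok , H-ok = skip , ≡ᵇ-true⁻ |L|≡p , L-ok , H-ok

splitsAs-intro : ∀ i p PL PR α → skips i α ≡ true → length (lows i α) ≡ p → PL (lows i α) ≡ true → PR (highs i α) ≡ true →
  splitsAs i p PL PR α ≡ true
splitsAs-intro i p PL PR α skip |L|≡p L-ok H-ok = ∧-true⁺ skip (∧-true⁺ (≡ᵇ-true⁺ |L|≡p) (∧-true⁺ L-ok H-ok))

module _ (i : ℕ) (PL PR : List ℕ → Bool) (x : List ℕ) where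

  splitsAs-low : ∀ {a} p → a ≤ i → splitsAs i (suc p) PL PR (a ∷ x) ≡ splitsAs i p (λ L → PL (a ∷ L)) PR x
  splitsAs-low p a≤i with low-∷ x a≤i
  ... | eL , eH , eS rewrite eL | eH | eS = refl

  splitsAs-low-0 : ∀ {a} → a ≤ i → splitsAs i 0 PL PR (a ∷ x) ≡ false
  splitsAs-low-0 a≤i with low-∷ x a≤i
  ... | eL , _ , eS rewrite eL | eS = ∧-zeroʳ (skips i x)

  splitsAs-gap : ∀ p → splitsAs i p PL PR (suc i ∷ x) ≡ false
  splitsAs-gap p rewrite skips-gap i x = refl

  splitsAs-high : ∀ {a} p → suc i < a → splitsAs i p PL PR (a ∷ x) ≡ splitsAs i p PL (λ R → PR ((a ∸ suc i) ∷ R)) x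
  splitsAs-high p i+1<a with high-∷ x i+1<a
  ... | eL , eH , eS rewrite eL | eH | eS = refl

  splitsAs-long : ∀ p → length (lows i x) ≤ p → splitsAs i (suc p) PL PR x ≡ false
  splitsAs-long p short rewrite ≡ᵇ-false⁺ (<⇒≢ (s≤s short)) = ∧-zeroʳ (skips i x)

lows-length : ∀ i x → length (lows i x) ≤ length x
lows-length i []      = z≤n
lows-length i (a ∷ x) with a ≤ᵇ i
... | true  = s≤s (lows-length i x)
... | false = m≤n⇒m≤1+n (lows-length i x)

nC[1+n]≡0 : ∀ n → n C suc n ≡ 0
nC[1+n]≡0 n rewrite ≤ᵇ-false⁺ (n<1+n n) = refl

count-splitsAs : ∀ i r (PL PR : List ℕ → Bool) n p q → p + q ≡ n →
  count (splitsAs i p PL PR) (prefSets n (i + suc r)) ≡ (n C p) * count PL (prefSets p i) * count PR (prefSets q r)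

count-splitsAs-lowHead : ∀ i r (PL PR : List ℕ → Bool) n p q → p + q ≡ n →
  sumBelow i (λ b → count (λ x → splitsAs i (suc p) PL PR (suc b ∷ x)) (prefSets n (i + suc r)))
    ≡ (n C p) * count PL (prefSets (suc p) i) * count PR (prefSets q r)
count-splitsAs-lowHead i r PL PR n p q p+q≡n = begin
  sumBelow i (λ b → count (λ x → splitsAs i (suc p) PL PR (suc b ∷ x)) (prefSets n (i + suc r)))
    ≡⟨ sumBelow-cong i _ _ (λ b b<i →
         trans (count-≗ _ _ (prefSets n (i + suc r)) (λ x → splitsAs-low i PL PR x p b<i))
               (count-splitsAs i r (λ L → PL (suc b ∷ L)) PR n p q p+q≡n)) ⟩
  sumBelow i (λ b → (n C p) * count (λ L → PL (suc b ∷ L)) (prefSets p i) * cR)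
    ≡⟨ sumBelow-*ʳ i cR _ ⟩
  sumBelow i (λ b → (n C p) * count (λ L → PL (suc b ∷ L)) (prefSets p i)) * cR
    ≡⟨ cong (_* cR) (sumBelow-*ˡ i (n C p) _) ⟩
  (n C p) * sumBelow i (λ b → count (λ L → PL (suc b ∷ L)) (prefSets p i)) * cR
    ≡⟨ cong (λ c → (n C p) * c * cR) (count-prefSets-suc PL p i) ⟨
  (n C p) * count PL (prefSets (suc p) i) * cR ∎
  where
  open ≡-Reasoning
  cR = count PR (prefSets q r)

count-splitsAs-high : ∀ i p (PL PR : List ℕ → Bool) j xs →
  count (λ x → splitsAs i p PL PR (suc (i + suc j) ∷ x)) xs ≡ count (splitsAs i p PL (λ R → PR (suc j ∷ R))) xs
count-splitsAs-high i p PL PR j xs = count-≗ _ _ xs (λ x →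
  trans (splitsAs-high i PL PR x p (s≤s (subst (_≤ i + suc j) (+-comm i 1) (+-monoʳ-≤ i (s≤s z≤n)))))
        (cong (λ a → splitsAs i p PL (λ R → PR (a ∷ R)) x) (m+n∸m≡n i (suc j))))

count-splitsAs-highHead : ∀ i r (PL PR : List ℕ → Bool) n p q → p + q ≡ suc n →
  sumBelow r (λ j → count (λ x → splitsAs i p PL PR (suc (i + suc j) ∷ x)) (prefSets n (i + suc r)))
    ≡ (n C p) * count PL (prefSets p i) * count PR (prefSets q r)
count-splitsAs-highHead i r PL PR n p zero p+0≡1+n = begin
  sumBelow r (λ j → count (λ x → splitsAs i p PL PR (suc (i + suc j) ∷ x)) (prefSets n (i + suc r)))
    ≡⟨ sumBelow-zero r _ (λ j _ → trans (count-splitsAs-high i p PL PR j xs) (noHigh j)) ⟩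
  0
    ≡⟨ cong (λ c → c * count PL (prefSets (suc n) i) * count PR (prefSets 0 r)) (nC[1+n]≡0 n) ⟨
  (n C suc n) * count PL (prefSets (suc n) i) * count PR (prefSets 0 r)
    ≡⟨ cong (λ p → (n C p) * count PL (prefSets p i) * count PR (prefSets 0 r)) p≡1+n ⟨
  (n C p) * count PL (prefSets p i) * count PR (prefSets 0 r) ∎
  where
  open ≡-Reasoning
  p≡1+n : p ≡ suc n
  p≡1+n = trans (sym (+-identityʳ p)) p+0≡1+n
  xs = prefSets n (i + suc r)
  tooLong : ∀ R {x} → length x ≡ n → splitsAs i p PL R x ≡ false
  tooLong R {x} |x| rewrite p≡1+n = splitsAs-long i PL R x n (≤-trans (lows-length i x) (≤-reflexive |x|))
  noHigh : ∀ j → count (splitsAs i p PL (λ R → PR (suc j ∷ R))) xs ≡ 0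
  noHigh j = count-none _ xs (All.map (λ {x} → tooLong (λ R → PR (suc j ∷ R)) {x}) (prefSets-length n (i + suc r)))
count-splitsAs-highHead i r PL PR n p (suc q) p+q+1≡n+1 = begin
  sumBelow r (λ j → count (λ x → splitsAs i p PL PR (suc (i + suc j) ∷ x)) (prefSets n (i + suc r)))
    ≡⟨ sumBelow-cong r _ _ (λ j _ → trans (count-splitsAs-high i p PL PR j (prefSets n (i + suc r)))
                                          (count-splitsAs i r PL (λ R → PR (suc j ∷ R)) n p q p+q≡n)) ⟩
  sumBelow r (λ j → (n C p) * cL * count (λ R → PR (suc j ∷ R)) (prefSets q r))
    ≡⟨ sumBelow-*ˡ r ((n C p) * cL) _ ⟩
  (n C p) * cL * sumBelow r (λ j → count (λ R → PR (suc j ∷ R)) (prefSets q r))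
    ≡⟨ cong ((n C p) * cL *_) (count-prefSets-suc PR q r) ⟨
  (n C p) * cL * count PR (prefSets (suc q) r) ∎
  where
  open ≡-Reasoning
  cL = count PL (prefSets p i)
  p+q≡n : p + q ≡ n
  p+q≡n = suc-injective (trans (sym (+-suc p q)) p+q+1≡n+1)

count-splitsAs i r PL PR zero zero zero _ with PL [] | PR []
... | true  | true  = refl
... | true  | false = refl
... | false | _     = refl
count-splitsAs i r PL PR (suc n) p q p+q≡1+n = begin
  count (splitsAs i p PL PR) (prefSets (suc n) (i + suc r))
    ≡⟨ count-prefSets-suc (splitsAs i p PL PR) n (i + suc r) ⟩
  sumBelow (i + suc r) head
    ≡⟨ sumBelow-+ i (suc r) head ⟩
  sumBelow i head + (head (i + 0) + sumBelow r (λ j → head (i + suc j)))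
    ≡⟨ cong (λ c → sumBelow i head + (c + sumBelow r (λ j → head (i + suc j)))) noGapHead ⟩
  sumBelow i head + sumBelow r (λ j → head (i + suc j))
    ≡⟨ lowAndHigh p p+q≡1+n ⟩
  (suc n C p) * count PL (prefSets p i) * count PR (prefSets q r) ∎
  where
  open ≡-Reasoning
  head : ℕ → ℕ
  head b = count (λ x → splitsAs i p PL PR (suc b ∷ x)) (prefSets n (i + suc r))
  noGapHead : head (i + 0) ≡ 0
  noGapHead = count-never _ (prefSets n (i + suc r))
    (λ x → subst (λ c → splitsAs i p PL PR (suc c ∷ x) ≡ false) (sym (+-identityʳ i)) (splitsAs-gap i PL PR x p))
  lowAndHigh : ∀ p → p + q ≡ suc n →
    sumBelow i (λ b → count (λ x → splitsAs i p PL PR (suc b ∷ x)) (prefSets n (i + suc r)))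
      + sumBelow r (λ j → count (λ x → splitsAs i p PL PR (suc (i + suc j) ∷ x)) (prefSets n (i + suc r)))
      ≡ (suc n C p) * count PL (prefSets p i) * count PR (prefSets q r)
  lowAndHigh zero e =
    cong₂ _+_ (sumBelow-zero i _ (λ b b<i → count-never _ (prefSets n (i + suc r)) (λ x → splitsAs-low-0 i PL PR x b<i)))
              (count-splitsAs-highHead i r PL PR n 0 q e)
  lowAndHigh (suc p) e = begin
    _ ≡⟨ cong₂ _+_ (count-splitsAs-lowHead i r PL PR n p q (suc-injective e)) (count-splitsAs-highHead i r PL PR n (suc p) q e) ⟩
    (n C p) * cL * cR + (n C suc p) * cL * cR ≡⟨ *-distribʳ-+ cR ((n C p) * cL) ((n C suc p) * cL) ⟨
    ((n C p) * cL + (n C suc p) * cL) * cR    ≡⟨ cong (_* cR) (*-distribʳ-+ cL (n C p) (n C suc p)) ⟨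
    (n C p + n C suc p) * cL * cR             ≡⟨ cong (λ c → c * cL * cR) (nCk+nC[k+1]≡[n+1]C[k+1] n p) ⟩
    (suc n C suc p) * cL * cR                 ∎
    where
    cL = count PL (prefSets (suc p) i)
    cR = count PR (prefSets q r)

parkingFn≤ : ℕ → ℕ → List ℕ → Bool
parkingFn≤ m t α = allLe t α ∧ (flaws m α ≡ᵇ 0)

parkingFn≤-from : ℕ → ℕ → ℕ → List ℕ → Bool
parkingFn≤-from m t h α = allLe t α ∧ headIs h α ∧ (flaws m α ≡ᵇ 0)

parkingFn≤-parts : ∀ m t α → parkingFn≤ m t α ≡ true → allLe t α ≡ true × flaws m α ≡ 0
parkingFn≤-parts m t α pf with ∧-true⁻ (allLe t α) pf
... | α≤t , parks = α≤t , ≡ᵇ-true⁻ parks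

parkingFn≤-from-parts : ∀ m t h α → parkingFn≤-from m t h α ≡ true → allLe t α ≡ true × flaws m α ≡ 0
parkingFn≤-from-parts m t h α pf with ∧-true⁻ (allLe t α) pf
... | α≤t , rest = α≤t , ≡ᵇ-true⁻ (proj₂ (∧-true⁻ (headIs h α) rest))

tilde : ℕ → ℕ → ℕ → ℕ → List ℕ → Bool
tilde n s k l α = allLe s α ∧ headIs l α ∧ (flaws n α ≡ᵇ k) ∧ (mα n α <ᵇ l)

tilde-intro : ∀ n s k {l} x → allLe s (l ∷ x) ≡ true → flaws n (l ∷ x) ≡ k → mα n (l ∷ x) < l →
  tilde n s k l (l ∷ x) ≡ true
tilde-intro n s k {l} x α≤s flaws≡k mα<l =
  ∧-true⁺ α≤s (∧-true⁺ (≡ᵇ-true⁺ {l} refl) (∧-true⁺ (≡ᵇ-true⁺ flaws≡k) (<ᵇ-true⁺ mα<l)))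

tilde-parts : ∀ n s k l α → tilde n s k l α ≡ true → allLe s α ≡ true × flaws n α ≡ k × mα n α < l
tilde-parts n s k l α isTilde with ∧-true⁻ (allLe s α) isTilde
... | α≤s , rest with ∧-true⁻ (headIs l α) rest
... | _ , rest′ with ∧-true⁻ (flaws n α ≡ᵇ k) rest′
... | flaws≡k , mα<l = α≤s , ≡ᵇ-true⁻ flaws≡k , <ᵇ-true⁻ mα<l

-- The tails x of the sets l ∷ x counted by pTilde n s k l whose last free space is i + 1.
gapSplit : ℕ → ℕ → ℕ → ℕ → ℕ → List ℕ → Bool
gapSplit n s k l i =
  splitsAs i (i + 1 ∸ k) (parkingFn≤ i i) (λ R → parkingFn≤-from (n + k ∸ i ∸ 1) (s ∸ i ∸ 1) (l ∸ i ∸ 1) ((l ∸ i ∸ 1) ∷ R))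

gapTerm : ℕ → ℕ → ℕ → ℕ → ℕ → ℕ
gapTerm n s k l i = ((n ∸ 1) C (i + 1 ∸ k)) * pLe (i + 1 ∸ k) i i * pHead (l ∸ i ∸ 1) (n + k ∸ i ∸ 1) (s ∸ i ∸ 1)

∸-∸-1 : ∀ a i → a ∸ i ∸ 1 ≡ a ∸ suc i
∸-∸-1 a i = trans (∸-+-assoc a i 1) (cong (a ∸_) (+-comm i 1))

pHead-0 : ∀ m t → pHead 0 m t ≡ 0
pHead-0 zero    t = refl
pHead-0 (suc m) t = trans (count-prefSets-suc _ m (suc m))
  (sumBelow-zero (suc m) _ (λ b _ → count-never _ (prefSets m (suc m)) (λ x → ∧-zeroʳ (allLe t (suc b ∷ x)))))

count-parkingFn-tails : ∀ q r t h → t ≤ r → t ≤ suc q → suc h ≤ suc q →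
  count (λ R → parkingFn≤-from (suc q) t (suc h) (suc h ∷ R)) (prefSets q r) ≡ pHead (suc h) (suc q) t
count-parkingFn-tails q r t h t≤r t≤1+q h<1+q = begin
  count (λ R → PF (suc h ∷ R)) (prefSets q r)        ≡⟨ count-≗ _ _ (prefSets q r) reorder ⟩
  count (λ x → allLe t x ∧ rest x) (prefSets q r)     ≡⟨ count-allLe-prefSets t r t≤r rest q ⟩
  count (λ x → allLe t x ∧ rest x) (prefSets q t)     ≡⟨ count-allLe-prefSets t (suc q) t≤1+q rest q ⟨
  count (λ x → allLe t x ∧ rest x) (prefSets q (suc q)) ≡⟨ count-≗ _ _ (prefSets q (suc q)) reorder ⟨
  count (λ R → PF (suc h ∷ R)) (prefSets q (suc q))  ≡⟨ count-prefSets-head PF q (suc q) h h<1+q otherHead ⟨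
  count PF (prefSets (suc q) (suc q))                 ∎
  where
  open ≡-Reasoning
  PF = parkingFn≤-from (suc q) t (suc h)
  rest : List ℕ → Bool
  rest x = (suc h ≤ᵇ t) ∧ (headIs (suc h) (suc h ∷ x) ∧ (flaws (suc q) (suc h ∷ x) ≡ᵇ 0))
  reorder : ∀ x → PF (suc h ∷ x) ≡ allLe t x ∧ rest x
  reorder x = trans (cong (_∧ _) (∧-comm (suc h ≤ᵇ t) (allLe t x))) (∧-assoc (allLe t x) (suc h ≤ᵇ t) _)
  otherHead : ∀ b x → b ≢ h → PF (suc b ∷ x) ≡ false
  otherHead b x b≢h rewrite ≡ᵇ-false⁺ b≢h = ∧-zeroʳ (allLe t (suc b ∷ x))

count-splitsAs-parkingFns : ∀ i r n p q h t → p + q ≡ n → 0 < h → h ≤ suc q → t ≤ r → t ≤ suc q →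
  count (splitsAs i p (parkingFn≤ i i) (λ R → parkingFn≤-from (suc q) t h (h ∷ R))) (prefSets n (i + suc r))
    ≡ (n C p) * pLe p i i * pHead h (suc q) t
count-splitsAs-parkingFns i r n p q (suc h) t p+q≡n _ h<1+q t≤r t≤1+q =
  trans (count-splitsAs i r _ _ n p q p+q≡n) (cong ((n C p) * pLe p i i *_) (count-parkingFn-tails q r t h t≤r t≤1+q h<1+q))

count-gapSplit : ∀ n′ s k l i → k ≤ suc i → suc i < l → l < s → s ≤ suc n′ →
  count (gapSplit (suc n′) s k l i) (prefSets n′ (suc n′)) ≡ gapTerm (suc n′) s k l i
count-gapSplit n′ s k l i k≤1+i i+1<l l<s s≤n = begin
  count (gapSplit n s k l i) (prefSets n′ n)
    ≡⟨ cong (λ m → count (gapSplit n s k l i) (prefSets n′ m)) n≡i+1+r ⟩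
  count (gapSplit n s k l i) (prefSets n′ (i + suc r))
    ≡⟨ subst (λ N → count (splitsAs i p (parkingFn≤ i i) (λ R → parkingFn≤-from N t h (h ∷ R))) (prefSets n′ (i + suc r))
                      ≡ (n′ C p) * pLe p i i * pHead h N t)
             (sym N≡1+q) (count-splitsAs-parkingFns i r n′ p q h t p+q≡n′ 0<h h≤1+q t≤r t≤1+q) ⟩
  gapTerm n s k l i ∎
  where
  open ≡-Reasoning
  n = suc n′
  r = n′ ∸ i
  p = i + 1 ∸ k
  q = n′ ∸ p
  h = l ∸ i ∸ 1
  t = s ∸ i ∸ 1
  N = n + k ∸ i ∸ 1
  i<n′ : i < n′
  i<n′ = ≤-pred (<-≤-trans i+1<l (≤-trans (<⇒≤ l<s) s≤n))
  n≡i+1+r : n ≡ i + suc r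
  n≡i+1+r = sym (trans (+-suc i r) (cong suc (m+[n∸m]≡n (<⇒≤ i<n′))))
  p+k≡1+i : p + k ≡ suc i
  p+k≡1+i = trans (m∸n+n≡m (subst (k ≤_) (+-comm 1 i) k≤1+i)) (+-comm i 1)
  p+q≡n′ : p + q ≡ n′
  p+q≡n′ = m+[n∸m]≡n (≤-trans (m∸n≤m (i + 1) k) (subst (_≤ n′) (+-comm 1 i) i<n′))
  N≡r+k : N ≡ r + k
  N≡r+k = trans (∸-∸-1 (n + k) i) (+-∸-comm k (s≤s (<⇒≤ i<n′)))
  N≡1+q : N ≡ suc q
  N≡1+q = trans N≡r+k (sym (balance⇒ p (suc q) r k i (trans (+-suc p q) (trans (cong suc p+q≡n′) n≡i+1+r)) p+k≡1+i))
  0<h : 0 < h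
  0<h = subst (0 <_) (sym (∸-∸-1 l i)) (m<n⇒0<n∸m i+1<l)
  t≤r : t ≤ r
  t≤r = subst (_≤ r) (sym (∸-∸-1 s i)) (∸-monoˡ-≤ (suc i) s≤n)
  t≤1+q : t ≤ suc q
  t≤1+q = subst (t ≤_) N≡1+q (subst (t ≤_) (sym N≡r+k) (≤-trans t≤r (m≤m+n r k)))
  h≤1+q : h ≤ suc q
  h≤1+q = ≤-trans (∸-monoˡ-≤ 1 (∸-monoˡ-≤ i (<⇒≤ l<s))) t≤1+q

module AtGap {n s k l i : ℕ} (x : List ℕ) (i+1<l : suc i < l) (l<s : l < s) (s≤n : s ≤ n)
             (|α| : length (l ∷ x) ≡ n) where

  private
    r = n ∸ suc i
    α = l ∷ x
    p = i + 1 ∸ k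
    rightPF = parkingFn≤-from (r + k) (s ∸ suc i) (l ∸ suc i)

    i<s : i < s
    i<s = <-trans (n<1+n i) (<-trans i+1<l l<s)

    highs≡ : highs i α ≡ (l ∸ suc i) ∷ highs i x
    highs≡ = highs-high x i+1<l

    i<n : i < n
    i<n = <-≤-trans i<s s≤n

    n≡i+1+r : n ≡ i + suc r
    n≡i+1+r = sym (trans (+-suc i r) (m+[n∸m]≡n i<n))

    s∸[1+i]≤r : s ∸ suc i ≤ r
    s∸[1+i]≤r = ∸-monoˡ-≤ (suc i) s≤n

    n+k∸[1+i]≡r+k : n + k ∸ suc i ≡ r + k
    n+k∸[1+i]≡r+k = +-∸-comm k i<n

    gapSplit≡ : gapSplit n s k l i x ≡ splitsAs i p (parkingFn≤ i i) rightPF α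
    gapSplit≡ rewrite ∸-∸-1 (n + k) i | ∸-∸-1 s i | ∸-∸-1 l i | n+k∸[1+i]≡r+k = sym (splitsAs-high i (parkingFn≤ i i) rightPF x p i+1<l)

    ≡p⇒+k≡1+i : ∀ {m} → k ≤ suc i → m ≡ p → m + k ≡ suc i
    ≡p⇒+k≡1+i k≤1+i refl = trans (m∸n+n≡m (subst (k ≤_) (+-comm 1 i) k≤1+i)) (+-comm i 1)

    +k≡1+i⇒≡p : ∀ {m} → m + k ≡ suc i → m ≡ p
    +k≡1+i⇒≡p {m} m+k≡1+i = trans (sym (m+n∸n≡m m k)) (cong (_∸ k) (trans m+k≡1+i (+-comm 1 i)))

    α≤s⇒highs≤ : allLe s α ≡ true → allLe (s ∸ suc i) (highs i α) ≡ true
    α≤s⇒highs≤ α≤s = trans (sym (allLe-highs i s α i<s)) α≤s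

  gap⇒ : tilde n s k l α ≡ true → mα n α ≡ suc i → k ≤ suc i × gapSplit n s k l i x ≡ true
  gap⇒ isTilde last with tilde-parts n s k l α isTilde
  ... | α≤s , flaws≡k , _ with lastFree-gap⇒ i r k n≡i+1+r α |α| (allLe-mono (highs i α) s∸[1+i]≤r (α≤s⇒highs≤ α≤s)) flaws≡k last
  ... | skip , noFail , |L|+k≡1+i , parks =
    subst (k ≤_) |L|+k≡1+i (m≤n+m k _) , subst (_≡ true) (sym gapSplit≡) splits
    where
    head : headIs (l ∸ suc i) (highs i α) ≡ true
    head = subst (λ H → headIs (l ∸ suc i) H ≡ true) (sym highs≡) (≡ᵇ-true⁺ {l ∸ suc i} refl)
    splits : splitsAs i p (parkingFn≤ i i) rightPF α ≡ true
    splits = splitsAs-intro i p (parkingFn≤ i i) rightPF α skip (+k≡1+i⇒≡p |L|+k≡1+i)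
               (∧-true⁺ (lows-allLe i α) (≡ᵇ-true⁺ noFail))
               (∧-true⁺ (α≤s⇒highs≤ α≤s) (∧-true⁺ head (≡ᵇ-true⁺ parks)))

  gap⇐ : k ≤ suc i → gapSplit n s k l i x ≡ true → tilde n s k l α ≡ true × mα n α ≡ suc i
  gap⇐ k≤1+i splits with splitsAs-parts i p (parkingFn≤ i i) rightPF α (trans (sym gapSplit≡) splits)
  ... | skip , |L|≡p , L-PF , H-PF with parkingFn≤-parts i i (lows i α) L-PF | parkingFn≤-from-parts _ _ _ (highs i α) H-PF
  ... | _ , noFail | H≤ , parks
    with lastFree-gap⇐ i r k n≡i+1+r α |α| (allLe-mono (highs i α) s∸[1+i]≤r H≤) skip noFail (≡p⇒+k≡1+i k≤1+i |L|≡p) parks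
  ... | flaws≡k , last =
    tilde-intro n s k x (trans (allLe-highs i s α i<s) H≤) flaws≡k (subst (_< l) (sym last) i+1<l) , last

flawed⇒mα≢0 : ∀ n α k → length α ≡ n → flaws n α ≡ suc k → mα n α ≢ 0
flawed⇒mα≢0 n α k |α| flawed noFree = 1+n≢0 (+-cancelˡ-≡ n (suc k) 0 (begin
  n + suc k                   ≡⟨ cong₂ _+_ (sym (trans (full⇒occupied≡length F full) (|finalOcc| n α))) (sym flawed) ⟩
  occupied F + flaws n α      ≡⟨ occupied+flaws n α ⟩
  length α                    ≡⟨ |α| ⟩
  n                           ≡⟨ +-identityʳ n ⟨
  n + 0                       ∎))
  where
  open ≡-Reasoning
  F = finalOcc n α
  full : and F ≡ true
  full = lastFreeFrom≡0⇒full 0 F noFree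

pTilde-by-gap : ∀ n′ s k′ l′ → suc (suc l′) < s → s ≤ suc n′ →
  pTilde (suc n′) s (suc k′) (suc (suc l′)) ≡ sumFromTo k′ l′ (gapTerm (suc n′) s (suc k′) (suc (suc l′)))
pTilde-by-gap n′ s k′ l′ l<s s≤n = begin
  count (tilde n s k l) (prefSets (suc n′) n)
    ≡⟨ count-prefSets-head (tilde n s k l) n′ n (suc l′) (≤-trans (<⇒≤ l<s) s≤n) otherHead ⟩
  count (λ x → tilde n s k l (l ∷ x)) (prefSets n′ n)
    ≡⟨ count-partition _ (gapSplit n s k l) k′ l′ (prefSets n′ n) (All.map (λ {x} → byGap x) (prefSets-length n′ n)) ⟩
  sumFromTo k′ l′ (λ i → count (gapSplit n s k l i) (prefSets n′ n))
    ≡⟨ sumFromTo-cong k′ l′ _ _ (λ i k′≤i i≤l′ → count-gapSplit n′ s k l i (s≤s k′≤i) (s≤s (s≤s i≤l′)) l<s s≤n) ⟩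
  sumFromTo k′ l′ (gapTerm n s k l) ∎
  where
  open ≡-Reasoning
  n = suc n′
  k = suc k′
  l = suc (suc l′)
  otherHead : ∀ b x → b ≢ suc l′ → tilde n s k l (suc b ∷ x) ≡ false
  otherHead b x b≢l rewrite ≡ᵇ-false⁺ b≢l = ∧-zeroʳ (allLe s (suc b ∷ x))
  byGap : ∀ x → length x ≡ n′ → indicator (tilde n s k l (l ∷ x)) ≡ sumFromTo k′ l′ (λ i → indicator (gapSplit n s k l i x))
  byGap x |x| = trans (indicator-by-value _ (mα n α) k′ l′ range) (sumFromTo-cong k′ l′ _ _ atGap)
    where
    α = l ∷ x
    |α| : length α ≡ n
    |α| = cong suc |x|
    range : tilde n s k l α ≡ true → k′ < mα n α × mα n α ≤ suc l′
    range isTilde with tilde-parts n s k l α isTilde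
    ... | _ , flawed , mα<l = k′<mα , ≤-pred mα<l
      where
      k′<mα : k′ < mα n α
      k′<mα = below (mα n α) refl
        where
        below : ∀ m → mα n α ≡ m → k′ < m
        below zero    last = ⊥-elim (flawed⇒mα≢0 n α k′ |α| flawed last)
        below (suc i) last = proj₁ (AtGap.gap⇒ x (subst (_< l) last mα<l) l<s s≤n |α| isTilde last)
    atGap : ∀ i → k′ ≤ i → i ≤ l′ → indicator (tilde n s k l α ∧ (mα n α ≡ᵇ suc i)) ≡ indicator (gapSplit n s k l i x)
    atGap i k′≤i i≤l′ = cong indicator (≡-by-truth ⇒ ⇐)
      where
      i+1<l : suc i < l
      i+1<l = s≤s (s≤s i≤l′)
      ⇒ : tilde n s k l α ∧ (mα n α ≡ᵇ suc i) ≡ true → gapSplit n s k l i x ≡ true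
      ⇒ both with ∧-true⁻ (tilde n s k l α) both
      ... | isTilde , last = proj₂ (AtGap.gap⇒ x i+1<l l<s s≤n |α| isTilde (≡ᵇ-true⁻ last))
      ⇐ : gapSplit n s k l i x ≡ true → tilde n s k l α ∧ (mα n α ≡ᵇ suc i) ≡ true
      ⇐ splits with AtGap.gap⇐ x i+1<l l<s s≤n |α| (s≤s k′≤i) splits
      ... | isTilde , last = ∧-true⁺ isTilde (≡ᵇ-true⁺ last)

pTilde-l≡1 : ∀ n s k → pTilde n s (suc k) 1 ≡ 0
pTilde-l≡1 n s k = count-none _ (prefSets n n) (All.map (λ {α} → noGap α) (prefSets-length n n))
  where
  noGap : ∀ α → length α ≡ n → tilde n s (suc k) 1 α ≡ false
  noGap α |α| = ¬T⇒≡false λ isTilde → impossible (tilde-parts n s (suc k) 1 α (T⇒≡true isTilde))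
    where
    impossible : allLe s α ≡ true × flaws n α ≡ suc k × mα n α < 1 → ⊥
    impossible (_ , flawed , mα<1) = flawed⇒mα≢0 n α k |α| flawed (n<1⇒n≡0 mα<1)

-- For l = 1 the range of the sum is empty, but l ∸ 2 = 0 leaves the term i = 0, which vanishes.
gapTerm-l≡1 : ∀ n s → sumFromTo 0 0 (gapTerm n s 1 1) ≡ 0
gapTerm-l≡1 n s = trans (+-identityʳ _) (trans (cong (c *_) (pHead-0 (n + 1 ∸ 0 ∸ 1) (s ∸ 0 ∸ 1))) (*-zeroʳ c))
  where
  c = ((n ∸ 1) C 0) * pLe 0 0 0

suc≤∸1⇒< : ∀ {l s} → suc l ≤ s ∸ 1 → suc l < s
suc≤∸1⇒< {s = suc s} l≤s = s≤s l≤s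

lemma6p2 : (n s k l : ℕ) → 1 ≤ k → k ≤ l → l ≤ s ∸ 1 → s ≤ n →
    pTilde n s k l ≡
      sumFromTo (k ∸ 1) (l ∸ 2) (λ i →
        ((n ∸ 1) C (i + 1 ∸ k)) * pLe (i + 1 ∸ k) i i
          * pHead (l ∸ i ∸ 1) (n + k ∸ i ∸ 1) (s ∸ i ∸ 1))
lemma6p2 n s zero l () _ _ _
lemma6p2 n s (suc k′) zero _ () _ _
lemma6p2 n s (suc (suc k′)) (suc zero) _ (s≤s ()) _ _
lemma6p2 n s (suc zero) (suc zero) _ _ _ _ = trans (pTilde-l≡1 n s 0) (sym (gapTerm-l≡1 n s))
lemma6p2 zero s (suc k′) (suc (suc l′)) _ _ l≤s∸1 s≤0 = ⊥-elim (n≮0 (<-≤-trans (suc≤∸1⇒< l≤s∸1) s≤0))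
lemma6p2 (suc n′) s (suc k′) (suc (suc l′)) _ _ l≤s∸1 s≤n = pTilde-by-gap n′ s k′ l′ (suc≤∸1⇒< l≤s∸1) s≤n
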